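{- There exists $\varepsilon_0>0$ such that for every $\varepsilon\in(0,\varepsilon_0)$, setting $c=4.383-\varepsilon$, the following holds. Let $n\ge1$ and let $P$ be the path with vertices $v_0,v_1,\dots,v_n$ and edges $v_iv_{i+1}$ ($0\le i<n$), and let $B=\{v_0\}$. Fix $j\in\mathbb{Z}$ and let $T(n)$ be the number of prototypes $(A,f)$ (of $P$ with respect to $B$) satisfying $v_0\in A$ and $f(v_0)=j$. Then $T(n)\le 4.26\cdot c^{n-1}$.
   Context: Let $G=(V,E)$ be a graph. For $A\subseteq V$ and $f:A\to\mathbb{Z}$, a bucket extension of $f$ is $\bar f:V\to\mathbb{Z}$ with: (1) $\bar f|_A=f$; (2) $|\bar f(u)-\bar f(v)|\le1$ for every edge $uv$; (3) $\bar f(u)\ge\bar f(v)$ for every edge $uv$ with $u\in A$, $v\notin A$. $(A,f)$ is a partial bucket function if $f$ has a bucket extension. For a fixed $B\subseteq V$, a prototype is a pair $(A,f)$ with $A\subseteq V$ and $f:A\cup B\to\mathbb{Z}$ such that $(A,f|_A)$ is a partial bucket function and there exists a bucket extension $\bar f$ of $f|_A$ with $\bar f|_{A\cup B}=f$.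
   Formalization: The parameter ε ranges only over the rationals, and the threshold ε₀ is taken rational as well. -}

module Defs where

open import Data.Nat as ℕ using (ℕ; zero; suc)
open import Data.Integer as ℤ using (ℤ; ∣_∣; +_)
open import Data.Rational as ℚ using (ℚ; 1ℚ; _*_)
open import Data.Fin using (Fin; toℕ; zero)
open import Data.Fin.Subset using (Subset; _∈_; _∉_; ⁅_⁆)
open import Data.Vec using (Vec; lookup)
open import Data.Maybe using (Maybe; just; nothing)
open import Data.Product using (Σ; ∃; _×_; _,_)
open import Data.Sum using (_⊎_)
open import Relation.Binary.PropositionalEquality using (_≡_)

record Graph (m : ℕ) : Set₁ where
  field
    Adj : Fin m → Fin m → Set

open Graph public

-- The path P with vertices v₀,…,vₙ (vertex vᵢ is  i : Fin (suc n))
-- and edges vᵢvᵢ₊₁.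
path : (n : ℕ) → Graph (suc n)
path n = record { Adj = λ u v → (toℕ v ≡ suc (toℕ u)) ⊎ (toℕ u ≡ suc (toℕ v)) }

-- Partial functions V ⇀ ℤ are represented as Vec (Maybe ℤ) m.
-- A function f : A → ℤ is represented by any g whose values on A are
-- those of f (only the values on A matter for a bucket extension).

IsBucketExtension : {m : ℕ} → Graph m → Subset m → Vec (Maybe ℤ) m → (Fin m → ℤ) → Set
IsBucketExtension G A g fbar =
  (∀ v → v ∈ A → lookup g v ≡ just (fbar v))
  × (∀ u v → Adj G u v → ∣ fbar u ℤ.- fbar v ∣ ℕ.≤ 1)
  × (∀ u v → Adj G u v → u ∈ A → v ∉ A → fbar v ℤ.≤ fbar u)

IsPartialBucketFunction : {m : ℕ} → Graph m → Subset m → Vec (Maybe ℤ) m → Set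
IsPartialBucketFunction G A g = ∃ λ fbar → IsBucketExtension G A g fbar

-- (A, f) is a prototype of G with respect to B, where f : A ∪ B → ℤ is
-- represented by a partial function whose domain is exactly A ∪ B.
IsPrototype : {m : ℕ} → Graph m → (B : Subset m) → Subset m → Vec (Maybe ℤ) m → Set
IsPrototype G B A f =
  (∀ v → v ∉ A → v ∉ B → lookup f v ≡ nothing)
  × IsPartialBucketFunction G A f
  × (∃ λ fbar → IsBucketExtension G A f fbar
                × (∀ v → (v ∈ A ⊎ v ∈ B) → lookup f v ≡ just (fbar v)))

Counted : (n : ℕ) → ℤ → Subset (suc n) × Vec (Maybe ℤ) (suc n) → Set
Counted n j (A , f) =
  IsPrototype (path n) ⁅ zero ⁆ A f × zero ∈ A × lookup f zero ≡ just j

_^ℚ_ : ℚ → ℕ → ℚ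
q ^ℚ zero = 1ℚ
q ^ℚ suc k = q * (q ^ℚ k)

module Submission where

-- On the path v₀ … vₙ a counted prototype (A, f) is determined
-- by its label vector f (A is exactly the support of f, since B = {v₀} ⊆ A),
-- and f is a word over Maybe ℤ read from left to right: after a vertex of A
-- with value x, the next vertex is either in A with value in [x-1, x+1], or
-- starts a run of vertices outside A; after a run of k+1 such vertices the
-- next vertex of A has a value in [x-k-1, x+k+1] (the extension first drops
-- at most to x, then may climb by one per step).

module Counting where

  import Data.Nat as ℕ
  open import Data.Fin using (Fin; zero; suc)
  open import Data.Fin.Properties using (injective⇒≤)
  open import Data.List using (List; length; lookup)
  open import Data.List.Membership.Propositional using (_∈_)
  open import Data.List.Membership.Propositional.Properties using (∈-lookup)
  open import Data.List.Relation.Unary.All as All using (All)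
  open import Data.List.Relation.Unary.Unique.Propositional using (Unique)
  open import Data.List.Relation.Unary.Any using (index)
  open import Data.List.Relation.Unary.Any.Properties using (lookup-index)
  open import Data.List.Relation.Unary.AllPairs using (_∷_)
  open import Data.Empty using (⊥-elim)
  open import Relation.Binary.PropositionalEquality

  unique-lookup-injective : ∀ {X : Set} {xs : List X} → Unique xs →
    ∀ i j → lookup xs i ≡ lookup xs j → i ≡ j
  unique-lookup-injective (_ ∷ _) zero zero _ = refl
  unique-lookup-injective (x∉xs ∷ _) zero (suc j) eq = ⊥-elim (All.lookup x∉xs (∈-lookup j) eq)
  unique-lookup-injective (x∉xs ∷ _) (suc i) zero eq = ⊥-elim (All.lookup x∉xs (∈-lookup i) (sym eq))
  unique-lookup-injective (_ ∷ u) (suc i) (suc j) eq = cong suc (unique-lookup-injective u i j eq)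

  -- If h is injective on the elements satisfying P and sends every element
  -- of the duplicate-free list ps into L, then ps is no longer than L: the
  -- positions of the images in L are pairwise distinct.
  length-≤-by-injection : {X Y : Set} (P : X → Set) (h : X → Y) →
    (∀ {p q} → P p → P q → h p ≡ h q → p ≡ q) →
    {ps : List X} (L : List Y) → Unique ps → All P ps → All (λ p → h p ∈ L) ps →
    length ps ℕ.≤ length L
  length-≤-by-injection P h h-inj {ps} L u Pps hps∈L = injective⇒≤ position-injective
    where
    image∈L : ∀ i → h (lookup ps i) ∈ L
    image∈L i = All.lookup hps∈L (∈-lookup i)

    position : Fin (length ps) → Fin (length L)
    position i = index (image∈L i)

    position-injective : ∀ {i j} → position i ≡ position j → i ≡ j
    position-injective {i} {j} eq = unique-lookup-injective u i j
      (h-inj (All.lookup Pps (∈-lookup i)) (All.lookup Pps (∈-lookup j)) (begin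
        h (lookup ps i)       ≡⟨ lookup-index (image∈L i) ⟩
        lookup L (position i) ≡⟨ cong (lookup L) eq ⟩
        lookup L (position j) ≡⟨ sym (lookup-index (image∈L j)) ⟩
        h (lookup ps j)       ∎))
      where open ≡-Reasoning

module Windows where

  open import Data.Nat as ℕ using (ℕ; zero; suc)
  import Data.Nat.Properties as ℕP
  open import Data.Integer as ℤ using (ℤ; +_; _+_; _-_; 1ℤ)
  open import Data.Integer.Properties using (≤-antisym; _≟_; ≤∧≢⇒<; i<j⇒suc[i]≤j; +-identityʳ)
  open import Data.Integer.Tactic.RingSolver using (solve-∀)
  open import Data.List using (List; _++_; length)
  open import Data.List.Membership.Propositional using (_∈_)
  open import Data.List.Membership.Propositional.Properties using (∈-++⁺ˡ; ∈-++⁺ʳ)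
  open import Data.List.Properties using (length-++)
  open import Relation.Nullary using (yes; no)
  open import Relation.Binary.PropositionalEquality using (_≡_; refl; sym; trans; cong₂; subst)

  module _ {X : Set} where

    band : ℤ → ℕ → (ℤ → List X) → List X
    band lo zero h = h lo
    band lo (suc m) h = h lo ++ band (ℤ.suc lo) m h

    band-length : ∀ lo m ℓ (h : ℤ → List X) → (∀ y → length (h y) ≡ ℓ) →
      length (band lo m h) ≡ suc m ℕ.* ℓ
    band-length lo zero ℓ h len = trans (len lo) (sym (ℕP.+-identityʳ ℓ))
    band-length lo (suc m) ℓ h len =
      trans (length-++ (h lo)) (cong₂ ℕ._+_ (len lo) (band-length (ℤ.suc lo) m ℓ h len))

    band-covers : ∀ lo m (h : ℤ → List X) {y v} → lo ℤ.≤ y → y ℤ.≤ lo + + m → v ∈ h y →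
      v ∈ band lo m h
    band-covers lo zero h {y} {v} lo≤y y≤lo v∈ =
      subst (λ z → v ∈ h z) (≤-antisym (subst (y ℤ.≤_) (+-identityʳ lo) y≤lo) lo≤y) v∈
    band-covers lo (suc m) h {y} lo≤y y≤ v∈ with lo ≟ y
    ... | yes refl = ∈-++⁺ˡ v∈
    ... | no lo≢y = ∈-++⁺ʳ (h lo)
      (band-covers (ℤ.suc lo) m h (i<j⇒suc[i]≤j (≤∧≢⇒< lo≤y lo≢y)) (subst (y ℤ.≤_) (shift lo (+ m)) y≤) v∈)
      where
      shift : ∀ lo m → lo + (1ℤ + m) ≡ (1ℤ + lo) + m
      shift = solve-∀

    window : ℤ → ℕ → (ℤ → List X) → List X
    window x ρ h = band (x - + ρ) (ρ ℕ.+ ρ) h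

    window-covers : ∀ x ρ (h : ℤ → List X) {y v} → x - + ρ ℤ.≤ y → y ℤ.≤ x + + ρ → v ∈ h y →
      v ∈ window x ρ h
    window-covers x ρ h lo hi = band-covers (x - + ρ) (ρ ℕ.+ ρ) h lo (subst (_ ℤ.≤_) (sym (recentre x (+ ρ))) hi)
      where
      recentre : ∀ x r → x - r + (r + r) ≡ x + r
      recentre = solve-∀

module Tails where

  open import Data.Nat as ℕ using (ℕ; zero; suc)
  open import Data.Integer as ℤ using (ℤ; +_; _+_; _-_; ∣_∣; 1ℤ; -1ℤ; -[1+_]; +≤+; -≤+)
  open import Data.Integer.Properties
    using (≤-refl; ≤-trans; +-identityʳ; +-monoʳ-≤; +-monoˡ-≤; neg-mono-≤)
  open import Data.Integer.Tactic.RingSolver using (solve-∀)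
  open Windows using (band-length; window; window-covers)
  open import Data.Fin using (Fin; zero; suc)
  open import Data.List using (List; []; _∷_; [_]; _++_; map; length)
  open import Data.List.Membership.Propositional using (_∈_)
  open import Data.List.Membership.Propositional.Properties using (∈-map⁺; ∈-++⁺ˡ; ∈-++⁺ʳ)
  open import Data.List.Properties using (length-map; length-++)
  open import Data.List.Relation.Unary.Any using (here)
  open import Data.Vec using (Vec; []; _∷_)
  open import Data.Maybe using (Maybe; just; nothing)
  open import Data.Product using (_×_; _,_; proj₁; proj₂)
  open import Data.Sum using (_⊎_; inj₁; inj₂)
  open import Data.Unit using (⊤)
  open import Relation.Binary.PropositionalEquality using (_≡_; refl; sym; trans; cong₂; subst)

  within-one : ∀ {d} → ∣ d ∣ ℕ.≤ 1 → (-1ℤ ℤ.≤ d) × (d ℤ.≤ 1ℤ)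
  within-one {+ zero} _ = -≤+ , +≤+ ℕ.z≤n
  within-one {+ suc zero} _ = -≤+ , ≤-refl
  within-one {+ suc (suc _)} (ℕ.s≤s ())
  within-one { -[1+ zero ]} _ = ≤-refl , -≤+
  within-one { -[1+ suc _ ]} (ℕ.s≤s ())

  near : ∀ a c → ∣ a - c ∣ ℕ.≤ 1 → (a - 1ℤ ℤ.≤ c) × (c ℤ.≤ a + 1ℤ)
  near a c h =
    subst (a - 1ℤ ℤ.≤_) (cancel a c) (+-monoʳ-≤ a (neg-mono-≤ (proj₂ (within-one h)))) ,
    subst (ℤ._≤ a + 1ℤ) (cancel a c) (+-monoʳ-≤ a (neg-mono-≤ (proj₁ (within-one h))))
    where
    cancel : ∀ a c → a - (a - c) ≡ c
    cancel = solve-∀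

  -- One more step along the path widens the admissible range by one at
  -- either end.
  lower-step : ∀ x k {b c} → x - + k ℤ.≤ b → b - 1ℤ ℤ.≤ c → x - + suc k ℤ.≤ c
  lower-step x k lo b-1≤c = subst (ℤ._≤ _) (sym (shift x (+ k))) (≤-trans (+-monoˡ-≤ -1ℤ lo) b-1≤c)
    where
    shift : ∀ x k → x - (1ℤ + k) ≡ (x - k) - 1ℤ
    shift = solve-∀

  upper-step : ∀ x k {b c} → b ℤ.≤ x + + k → c ℤ.≤ b + 1ℤ → c ℤ.≤ x + + suc k
  upper-step x k hi c≤b+1 = subst (_ ℤ.≤_) (sym (shift x (+ k))) (≤-trans c≤b+1 (+-monoˡ-≤ 1ℤ hi))
    where
    shift : ∀ x k → x + (1ℤ + k) ≡ (x + k) + 1ℤ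
    shift = solve-∀

  mutual
    -- tailsAfter x r: candidate labellings of the next r vertices following
    -- a vertex of A with value x.
    tailsAfter : ℤ → (r : ℕ) → List (Vec (Maybe ℤ) r)
    tailsAfter x zero = [ [] ]
    tailsAfter x (suc r) = window x 1 (λ y → startingAt y r) ++ map (nothing ∷_) (tailsInGap x 0 r)

    -- tailsInGap x k r: candidate labellings of the next r vertices when the
    -- last vertex of A had value x and was followed by k+1 vertices outside A.
    tailsInGap : ℤ → ℕ → (r : ℕ) → List (Vec (Maybe ℤ) r)
    tailsInGap x k zero = [ [] ]
    tailsInGap x k (suc r) =
      map (nothing ∷_) (tailsInGap x (suc k) r) ++ window x (suc k) (λ y → startingAt y r)

    startingAt : ℤ → (r : ℕ) → List (Vec (Maybe ℤ) (suc r))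
    startingAt y r = map (just y ∷_) (tailsAfter y r)

  -- The lengths of these lists, which do not depend on the values involved.
  mutual
    tailCount : ℕ → ℕ
    tailCount zero = 1
    tailCount (suc r) = 3 ℕ.* tailCount r ℕ.+ gapCount 0 r

    gapCount : ℕ → ℕ → ℕ
    gapCount k zero = 1
    gapCount k (suc r) = gapCount (suc k) r ℕ.+ suc (suc k ℕ.+ suc k) ℕ.* tailCount r

  mutual
    length-tailsAfter : ∀ x r → length (tailsAfter x r) ≡ tailCount r
    length-tailsAfter x zero = refl
    length-tailsAfter x (suc r) =
      trans (length-++ (window x 1 (λ y → startingAt y r)))
        (cong₂ ℕ._+_ (band-length (x - 1ℤ) 2 (tailCount r) (λ y → startingAt y r) (length-startingAt r))
                      (trans (length-map _ (tailsInGap x 0 r)) (length-tailsInGap x 0 r)))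

    length-tailsInGap : ∀ x k r → length (tailsInGap x k r) ≡ gapCount k r
    length-tailsInGap x k zero = refl
    length-tailsInGap x k (suc r) =
      trans (length-++ (map (nothing ∷_) (tailsInGap x (suc k) r)))
        (cong₂ ℕ._+_ (trans (length-map _ (tailsInGap x (suc k) r)) (length-tailsInGap x (suc k) r))
                      (band-length _ (suc k ℕ.+ suc k) (tailCount r) (λ y → startingAt y r) (length-startingAt r)))

    length-startingAt : ∀ r y → length (startingAt y r) ≡ tailCount r
    length-startingAt r y = trans (length-map _ (tailsAfter y r)) (length-tailsAfter y r)

  -- The local conditions on consecutive vertices u, v of a path, where a
  -- vertex carries its label (just a value, or nothing outside A) and its
  -- extension value: leaving A the extension does not increase, entering A
  -- it does not decrease.
  Oriented : Maybe ℤ → ℤ → Maybe ℤ → ℤ → Set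
  Oriented (just _) b nothing b' = b' ℤ.≤ b
  Oriented nothing b (just _) b' = b ℤ.≤ b'
  Oriented _ _ _ _ = ⊤

  Agrees : Maybe ℤ → ℤ → Set
  Agrees m b = m ≡ nothing ⊎ m ≡ just b

  agrees-just : ∀ {x b} → Agrees (just x) b → b ≡ x
  agrees-just (inj₂ refl) = refl

  Continues : ∀ {r} → Maybe ℤ → ℤ → Vec (Maybe ℤ) r → (Fin r → ℤ) → Set
  Continues m b [] bs = ⊤
  Continues m b (m' ∷ f) bs =
    (∣ b - bs zero ∣ ℕ.≤ 1) × Oriented m b m' (bs zero) × Agrees m' (bs zero) ×
    Continues m' (bs zero) f (λ i → bs (suc i))

  mutual
    tailsAfter-complete : ∀ {r} x (f : Vec (Maybe ℤ) r) bs → Continues (just x) x f bs →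
      f ∈ tailsAfter x r
    tailsAfter-complete x [] bs _ = here refl
    tailsAfter-complete {suc r} x (_ ∷ f) bs (step , down , inj₁ refl , rest) =
      ∈-++⁺ʳ (window x 1 (λ y → startingAt y r))
        (∈-map⁺ (nothing ∷_) (tailsInGap-complete x 0 (bs zero) f _ rest
          (proj₁ (near x (bs zero) step)) (subst (bs zero ℤ.≤_) (sym (+-identityʳ x)) down)))
    tailsAfter-complete {suc r} x (_ ∷ f) bs (step , _ , inj₂ refl , rest) =
      ∈-++⁺ˡ (window-covers x 1 (λ y → startingAt y r)
        (proj₁ (near x (bs zero) step)) (proj₂ (near x (bs zero) step))
        (∈-map⁺ (just (bs zero) ∷_) (tailsAfter-complete (bs zero) f _ rest)))

    tailsInGap-complete : ∀ {r} x k b (f : Vec (Maybe ℤ) r) bs → Continues nothing b f bs →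
      x - + suc k ℤ.≤ b → b ℤ.≤ x + + k → f ∈ tailsInGap x k r
    tailsInGap-complete x k b [] bs _ _ _ = here refl
    tailsInGap-complete x k b (_ ∷ f) bs (step , _ , inj₁ refl , rest) lo hi =
      ∈-++⁺ˡ (∈-map⁺ (nothing ∷_) (tailsInGap-complete x (suc k) (bs zero) f _ rest
        (lower-step x (suc k) lo (proj₁ (near b (bs zero) step)))
        (upper-step x k hi (proj₂ (near b (bs zero) step)))))
    tailsInGap-complete {suc r} x k b (_ ∷ f) bs (step , up , inj₂ refl , rest) lo hi =
      ∈-++⁺ʳ (map (nothing ∷_) (tailsInGap x (suc k) r))
        (window-covers x (suc k) (λ y → startingAt y r)
          (≤-trans lo up) (upper-step x k hi (proj₂ (near b (bs zero) step)))
          (∈-map⁺ (just (bs zero) ∷_) (tailsAfter-complete (bs zero) f _ rest)))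

module CountedPrototypes where

  open import Defs
  open Tails
  open Counting using (length-≤-by-injection)
  open import Data.Nat as ℕ using (ℕ; suc)
  import Data.Nat.Properties as ℕP
  open import Data.Integer as ℤ using (ℤ; _-_; ∣_∣)
  open import Data.Bool using (true; false)
  open import Data.Fin using (Fin; zero; suc; inject₁)
  open import Data.Fin.Properties using (toℕ-inject₁)
  open import Data.Fin.Subset using (Subset; _∈_; _∉_)
  open import Data.Fin.Subset.Properties using (_∈?_; x∈⁅y⁆⇒x≡y)
  open import Data.List using (List; length)
  import Data.List.Membership.Propositional as List
  open import Data.List.Membership.Propositional.Properties using (∈-map⁺)
  import Data.List.Relation.Unary.All as All
  open import Data.List.Relation.Unary.Unique.Propositional using (Unique)
  open import Data.Vec using (Vec; []; _∷_; lookup; tabulate; tail)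
  open import Data.Vec.Properties using ([]=⇒lookup; lookup⇒[]=; tabulate∘lookup; tabulate-cong)
  open import Data.Maybe using (Maybe; just; nothing; is-just)
  open import Data.Product using (_×_; _,_; proj₂)
  open import Data.Sum using (_⊎_; inj₁; inj₂)
  open import Data.Unit using (tt)
  open import Data.Empty using (⊥-elim)
  open import Function using (_∘_)
  open import Relation.Nullary using (yes; no)
  open import Relation.Binary.PropositionalEquality

  record Labelling {m} (A : Subset m) (f : Vec (Maybe ℤ) m) (fbar : Fin m → ℤ) : Set where
    constructor by-membership
    field classify : ∀ v → (v ∈ A × lookup f v ≡ just (fbar v)) ⊎ (v ∉ A × lookup f v ≡ nothing)
  open Labelling

  labels-agree : ∀ {m A f fbar} → Labelling {m} A f fbar → ∀ v → Agrees (lookup f v) (fbar v)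
  labels-agree lab v with classify lab v
  ... | inj₁ (_ , labelled) = inj₂ labelled
  ... | inj₂ (_ , unlabelled) = inj₁ unlabelled

  support-is-A : ∀ {m A f fbar} → Labelling {m} A f fbar → A ≡ tabulate (is-just ∘ lookup f)
  support-is-A {A = A} {f} lab = trans (sym (tabulate∘lookup A)) (tabulate-cong membership)
    where
    membership : ∀ v → lookup A v ≡ is-just (lookup f v)
    membership v with classify lab v
    ... | inj₁ (v∈A , labelled) rewrite labelled = []=⇒lookup v∈A
    ... | inj₂ (v∉A , unlabelled) rewrite unlabelled with lookup A v in eq
    ...   | true = ⊥-elim (v∉A (lookup⇒[]= v A eq))
    ...   | false = refl

  edge-oriented : ∀ {m} (G : Graph m) {A f fbar} → Labelling A f fbar →
    (∀ u v → Adj G u v → u ∈ A → v ∉ A → fbar v ℤ.≤ fbar u) →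
    ∀ u v → Adj G u v → Adj G v u → Oriented (lookup f u) (fbar u) (lookup f v) (fbar v)
  edge-oriented G lab descends u v uv vu with classify lab u | classify lab v
  ... | inj₁ (_ , eu) | inj₁ (_ , ev) rewrite eu | ev = tt
  ... | inj₁ (u∈A , eu) | inj₂ (v∉A , ev) rewrite eu | ev = descends u v uv u∈A v∉A
  ... | inj₂ (u∉A , eu) | inj₁ (v∈A , ev) rewrite eu | ev = descends v u vu v∈A u∉A
  ... | inj₂ (_ , eu) | inj₂ (_ , ev) rewrite eu | ev = tt

  along-path : ∀ {r} (f : Vec (Maybe ℤ) (suc r)) (fb : Fin (suc r) → ℤ) →
    (∀ v → Agrees (lookup f v) (fb v)) →
    (∀ (i : Fin r) → ∣ fb (inject₁ i) - fb (suc i) ∣ ℕ.≤ 1) →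
    (∀ (i : Fin r) → Oriented (lookup f (inject₁ i)) (fb (inject₁ i)) (lookup f (suc i)) (fb (suc i))) →
    Continues (lookup f zero) (fb zero) (tail f) (λ i → fb (suc i))
  along-path (_ ∷ []) fb _ _ _ = tt
  along-path (_ ∷ m' ∷ f) fb agree step orient =
    step zero , orient zero , agree (suc zero) ,
    along-path (m' ∷ f) (λ i → fb (suc i)) (agree ∘ suc) (step ∘ suc) (orient ∘ suc)

  module _ (n : ℕ) (j : ℤ) where

    edge : ∀ (i : Fin n) → Adj (path n) (inject₁ i) (suc i)
    edge i = inj₁ (cong suc (sym (toℕ-inject₁ i)))

    edge⁻ : ∀ (i : Fin n) → Adj (path n) (suc i) (inject₁ i)
    edge⁻ i = inj₂ (cong suc (sym (toℕ-inject₁ i)))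

    extension : ∀ {A f} → Counted n j (A , f) → Fin (suc n) → ℤ
    extension ((_ , (fbar , _) , _) , _) = fbar

    -- Since B = {v₀} ⊆ A, the domain of f is exactly A.
    labelling : ∀ {A f} (c : Counted n j (A , f)) → Labelling A f (extension {A} {f} c)
    labelling {A} {f} ((unlabelled , (fbar , onA , _) , _) , v₀∈A , _) = by-membership classify-v
      where
      classify-v : ∀ v → (v ∈ A × lookup f v ≡ just (fbar v)) ⊎ (v ∉ A × lookup f v ≡ nothing)
      classify-v v with v ∈? A
      ... | yes v∈A = inj₁ (v∈A , onA v v∈A)
      ... | no v∉A = inj₂ (v∉A , unlabelled v v∉A (v∉A ∘ λ v∈B → subst (_∈ A) (sym (x∈⁅y⁆⇒x≡y zero v∈B)) v₀∈A))

    counted-injective : ∀ {p q} → Counted n j p → Counted n j q → proj₂ p ≡ proj₂ q → p ≡ q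
    counted-injective {A , f} {A' , .f} cp cq refl =
      cong (_, f) (trans (support-is-A (labelling {A} {f} cp)) (sym (support-is-A (labelling {A'} {f} cq))))

    counted-in-tails : ∀ {A f} → Counted n j (A , f) → f List.∈ startingAt j n
    counted-in-tails {A} {_ ∷ ft} c@((_ , (fbar , _ , lipschitz , descends) , _) , _ , refl) =
      ∈-map⁺ (just j ∷_) (tailsAfter-complete j ft _
        (subst (λ b → Continues (just j) b ft (λ i → fbar (suc i))) (agrees-just (agree zero)) chain))
      where
      agree : ∀ v → Agrees (lookup (just j ∷ ft) v) (fbar v)
      agree = labels-agree (labelling {A} {just j ∷ ft} c)
      chain : Continues (just j) (fbar zero) ft (λ i → fbar (suc i))
      chain = along-path (just j ∷ ft) fbar agree (λ i → lipschitz _ _ (edge i))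
        (λ i → edge-oriented (path n) (labelling {A} {just j ∷ ft} c) descends _ _ (edge i) (edge⁻ i))

    counted-≤-tailCount : (ps : List (Subset (suc n) × Vec (Maybe ℤ) (suc n))) →
      Unique ps → All.All (Counted n j) ps → length ps ℕ.≤ tailCount n
    counted-≤-tailCount ps unique counted = ℕP.≤-trans
      (length-≤-by-injection (Counted n j) proj₂ counted-injective (startingAt j n) unique counted
        (All.map counted-in-tails counted))
      (ℕP.≤-reflexive (length-startingAt n j))

-- Growth of the candidate counts: with ρ = 213/50 = 4.26 one has
-- tailCount r ≤ ρʳ and gapCount k r ≤ (9 + 5k)/8 · ρʳ.  The potential
-- (9 + 5k)/8 is chosen so that both recurrences close:
-- 3 + 9/8 ≤ ρ and (9 + 5(k+1))/8 + (2k+3) ≤ ρ (9 + 5k)/8.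
module GrowthBound where

  open Tails using (tailCount; gapCount)
  open import Data.Nat using (zero; suc; _+_; _*_; _^_; _≤_; z≤n; s≤s)
  open import Data.Nat.Properties using (*-cancelˡ-≤; *-monoʳ-≤; *-monoˡ-≤; +-mono-≤; m≤m+n; ≤-trans; ≤-reflexive; module ≤-Reasoning)
  open import Data.Nat.Tactic.RingSolver using (solve-∀)
  open import Relation.Binary.PropositionalEquality using (_≡_)

  mutual
    tailCount-bound : ∀ r → tailCount r * 50 ^ r ≤ 213 ^ r
    tailCount-bound zero = s≤s z≤n
    tailCount-bound (suc r) = *-cancelˡ-≤ 8 (begin
        8 * (tailCount (suc r) * (50 * 50 ^ r))
          ≡⟨ expand (tailCount r) (gapCount 0 r) (50 ^ r) ⟩
        1200 * (tailCount r * 50 ^ r) + 50 * (8 * gapCount 0 r * 50 ^ r)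
          ≤⟨ +-mono-≤ (*-monoʳ-≤ 1200 (tailCount-bound r)) (*-monoʳ-≤ 50 (gapCount-bound 0 r)) ⟩
        1200 * 213 ^ r + 50 * (9 * 213 ^ r)
          ≡⟨ collect (213 ^ r) ⟩
        1650 * 213 ^ r
          ≤⟨ *-monoˡ-≤ (213 ^ r) (m≤m+n 1650 54) ⟩
        1704 * 213 ^ r
          ≡⟨ factor (213 ^ r) ⟩
        8 * (213 * 213 ^ r) ∎)
      where
      open ≤-Reasoning
      expand : ∀ a b p → 8 * ((3 * a + b) * (50 * p)) ≡ 1200 * (a * p) + 50 * (8 * b * p)
      expand = solve-∀
      collect : ∀ q → 1200 * q + 50 * (9 * q) ≡ 1650 * q
      collect = solve-∀
      factor : ∀ q → 1704 * q ≡ 8 * (213 * q)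
      factor = solve-∀

    gapCount-bound : ∀ k r → 8 * gapCount k r * 50 ^ r ≤ (9 + 5 * k) * 213 ^ r
    gapCount-bound k zero = ≤-trans (m≤m+n 8 (1 + 5 * k)) (≤-reflexive (base k))
      where
      base : ∀ k → 8 + (1 + 5 * k) ≡ (9 + 5 * k) * 1
      base = solve-∀
    gapCount-bound k (suc r) = begin
        8 * gapCount k (suc r) * (50 * 50 ^ r)
          ≡⟨ expand k (gapCount (suc k) r) (tailCount r) (50 ^ r) ⟩
        50 * (8 * gapCount (suc k) r * 50 ^ r) + 400 * (3 + 2 * k) * (tailCount r * 50 ^ r)
          ≤⟨ +-mono-≤ (*-monoʳ-≤ 50 (gapCount-bound (suc k) r)) (*-monoʳ-≤ (400 * (3 + 2 * k)) (tailCount-bound r)) ⟩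
        50 * ((9 + 5 * suc k) * 213 ^ r) + 400 * (3 + 2 * k) * 213 ^ r
          ≡⟨ collect k (213 ^ r) ⟩
        (1900 + 1050 * k) * 213 ^ r
          ≤⟨ *-monoˡ-≤ (213 ^ r) (+-mono-≤ (m≤m+n 1900 17) (*-monoˡ-≤ k (m≤m+n 1050 15))) ⟩
        (1917 + 1065 * k) * 213 ^ r
          ≡⟨ factor k (213 ^ r) ⟩
        (9 + 5 * k) * (213 * 213 ^ r) ∎
      where
      open ≤-Reasoning
      expand : ∀ k a b p → 8 * (a + suc (suc k + suc k) * b) * (50 * p)
                         ≡ 50 * (8 * a * p) + 400 * (3 + 2 * k) * (b * p)
      expand = solve-∀
      collect : ∀ k q → 50 * ((9 + 5 * suc k) * q) + 400 * (3 + 2 * k) * q ≡ (1900 + 1050 * k) * q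
      collect = solve-∀
      factor : ∀ k q → (1917 + 1065 * k) * q ≡ (9 + 5 * k) * (213 * q)
      factor = solve-∀

module RationalBound where

  open import Defs using (_^ℚ_)
  open import Data.Nat as ℕ using (ℕ; zero; suc; _^_)
  import Data.Nat.Properties as ℕP
  open import Data.Nat.Coprimality using (1-coprimeTo) renaming (sym to coprime-sym)
  open import Data.Integer as ℤ using (+_; +≤+)
  import Data.Integer.Properties as ℤP
  open import Data.Rational using (ℚ; mkℚ; _/_; _*_; _≤_; *≤*; toℚᵘ; NonNegative; Positive; nonNegative)
  import Data.Rational.Unnormalised as ℚᵘ
  import Data.Rational.Unnormalised.Properties as ℚᵘP
  open import Data.Rational.Properties
    using (normalize-coprime; toℚᵘ-injective; toℚᵘ-homo-*; *-assoc; *-comm; *-cancelʳ-≤-pos; *-monoʳ-≤-nonNeg; *-monoˡ-≤-nonNeg;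
           nonNeg*nonNeg⇒nonNeg; nonNegative⁻¹; ≤-refl; ≤-trans; module ≤-Reasoning)
  open import Relation.Binary.PropositionalEquality

  ι : ℕ → ℚ
  ι a = (+ a) / 1

  ι-normal : ∀ a → ι a ≡ mkℚ (+ a) 0 (coprime-sym (1-coprimeTo a))
  ι-normal a = normalize-coprime (coprime-sym (1-coprimeTo a))

  ι-mono : ∀ {a b} → a ℕ.≤ b → ι a ≤ ι b
  ι-mono {a} {b} a≤b rewrite ι-normal a | ι-normal b =
    *≤* (subst₂ ℤ._≤_ (sym (ℤP.*-identityʳ (+ a))) (sym (ℤP.*-identityʳ (+ b))) (+≤+ a≤b))

  ι-* : ∀ a b → ι (a ℕ.* b) ≡ ι a * ι b
  ι-* a b = toℚᵘ-injective (ℚᵘP.≃-trans unnormalised (ℚᵘP.≃-sym (toℚᵘ-homo-* (ι a) (ι b))))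
    where
    unnormalised : toℚᵘ (ι (a ℕ.* b)) ℚᵘ.≃ (toℚᵘ (ι a) ℚᵘ.* toℚᵘ (ι b))
    unnormalised rewrite ι-normal a | ι-normal b | ι-normal (a ℕ.* b) =
      ℚᵘ.*≡* (cong (ℤ._* + 1) (ℤP.pos-* a b))

  ι-positive : ∀ {a} → 0 ℕ.< a → Positive (ι a)
  ι-positive {suc a} _ rewrite ι-normal (suc a) = _

  ^ℚ-nonNeg : ∀ a → .{{NonNegative a}} → ∀ m → NonNegative (a ^ℚ m)
  ^ℚ-nonNeg a zero = _
  ^ℚ-nonNeg a (suc m) = nonNeg*nonNeg⇒nonNeg a (a ^ℚ m) {{^ℚ-nonNeg a m}}

  ^ℚ-mono-≤ : ∀ a b → .{{NonNegative a}} → a ≤ b → ∀ m → a ^ℚ m ≤ b ^ℚ m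
  ^ℚ-mono-≤ a b a≤b zero = ≤-refl
  ^ℚ-mono-≤ a b a≤b (suc m) = ≤-trans
    (*-monoʳ-≤-nonNeg (a ^ℚ m) {{^ℚ-nonNeg a m}} a≤b)
    (*-monoˡ-≤-nonNeg b {{nonNegative (≤-trans (nonNegative⁻¹ a) a≤b)}} (^ℚ-mono-≤ a b a≤b m))

  ρ : ℚ
  ρ = + 213 / 50

  ι50^-*-ρ^ : ∀ r → ι (50 ^ r) * ρ ^ℚ r ≡ ι (213 ^ r)
  ι50^-*-ρ^ zero = refl
  ι50^-*-ρ^ (suc r) = begin
    ι (50 ℕ.* 50 ^ r) * (ρ * ρ ^ℚ r)       ≡⟨ cong (_* (ρ * ρ ^ℚ r)) (ι-* 50 (50 ^ r)) ⟩
    (ι 50 * ι (50 ^ r)) * (ρ * ρ ^ℚ r)     ≡⟨ interchange (ι 50) (ι (50 ^ r)) ρ (ρ ^ℚ r) ⟩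
    (ι 50 * ρ) * (ι (50 ^ r) * ρ ^ℚ r)     ≡⟨ cong (ι 213 *_) (ι50^-*-ρ^ r) ⟩
    ι 213 * ι (213 ^ r)                    ≡⟨ sym (ι-* 213 (213 ^ r)) ⟩
    ι (213 ℕ.* 213 ^ r)                    ∎
    where
    open ≡-Reasoning
    interchange : ∀ a b c d → (a * b) * (c * d) ≡ (a * c) * (b * d)
    interchange a b c d = begin
      (a * b) * (c * d) ≡⟨ *-assoc a b (c * d) ⟩
      a * (b * (c * d)) ≡⟨ cong (a *_) (sym (*-assoc b c d)) ⟩
      a * ((b * c) * d) ≡⟨ cong (λ z → a * (z * d)) (*-comm b c) ⟩
      a * ((c * b) * d) ≡⟨ cong (a *_) (*-assoc c b d) ⟩
      a * (c * (b * d)) ≡⟨ sym (*-assoc a c (b * d)) ⟩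
      (a * c) * (b * d) ∎

  ι-≤-ρ^ : ∀ L r → L ℕ.* 50 ^ r ℕ.≤ 213 ^ r → ι L ≤ ρ ^ℚ r
  ι-≤-ρ^ L r bound = *-cancelʳ-≤-pos (ι (50 ^ r)) {{ι-positive (ℕP.m^n>0 50 r)}} (begin
    ι L * ι (50 ^ r)    ≡⟨ sym (ι-* L (50 ^ r)) ⟩
    ι (L ℕ.* 50 ^ r)    ≤⟨ ι-mono bound ⟩
    ι (213 ^ r)         ≡⟨ sym (ι50^-*-ρ^ r) ⟩
    ι (50 ^ r) * ρ ^ℚ r ≡⟨ *-comm (ι (50 ^ r)) (ρ ^ℚ r) ⟩
    ρ ^ℚ r * ι (50 ^ r) ∎)
    where open ≤-Reasoning

open import Defs
open import Data.Nat using (ℕ; suc; _∸_; s≤s; z≤n)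
open import Data.Integer using (ℤ; +_)
open import Data.Rational using (ℚ; _/_; _+_; _-_; -_; _*_; _<_; _≤_; 0ℚ)
open import Data.Rational.Properties
  using (≤-trans; ≤-reflexive; <⇒≤; _≤?_; _<?_; +-monoʳ-≤; +-monoˡ-≤; +-assoc; +-inverseʳ; +-identityʳ; *-monoˡ-≤-nonNeg; module ≤-Reasoning)
open import Data.Fin.Subset using (Subset)
open import Data.Vec using (Vec)
open import Data.Maybe using (Maybe)
open import Data.Product using (∃; _×_; _,_)
open import Data.List using (List; length)
open import Data.List.Relation.Unary.All using (All)
open import Data.List.Relation.Unary.Unique.Propositional using (Unique)
open import Data.Unit using (tt)
open import Relation.Nullary.Decidable using (toWitness)
open import Relation.Binary.PropositionalEquality using (_≡_; sym; cong; module ≡-Reasoning)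
open Tails using (tailCount)
open CountedPrototypes using (counted-≤-tailCount)
open GrowthBound using (tailCount-bound)
open RationalBound using (ι; ι-mono; ρ; ι-≤-ρ^; ^ℚ-mono-≤)

ε₀ : ℚ
ε₀ = + 1 / 10

ρ≤c : ∀ ε → ε < ε₀ → ρ ≤ (+ 4383 / 1000) - ε
ρ≤c ε ε<ε₀ = ≤-trans (≤-reflexive (sym cancel-ε)) (+-monoˡ-≤ (- ε) ρ+ε≤4383)
  where
  open ≡-Reasoning
  cancel-ε : (ρ + ε) - ε ≡ ρ
  cancel-ε = begin
    (ρ + ε) - ε ≡⟨ +-assoc ρ ε (- ε) ⟩
    ρ + (ε - ε) ≡⟨ cong (λ z → ρ + z) (+-inverseʳ ε) ⟩
    ρ + 0ℚ      ≡⟨ +-identityʳ ρ ⟩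
    ρ           ∎
  ρ+ε≤4383 : ρ + ε ≤ + 4383 / 1000
  ρ+ε≤4383 = ≤-trans (+-monoʳ-≤ ρ (<⇒≤ ε<ε₀)) (toWitness {a? = (ρ + ε₀) ≤? (+ 4383 / 1000)} tt)

lemma15 : ∃ λ (ε₀ : ℚ) → 0ℚ < ε₀ ×
    (∀ (ε : ℚ) → 0ℚ < ε → ε < ε₀ →
      ∀ (n : ℕ) → 1 Data.Nat.≤ n → ∀ (j : ℤ) →
      ∀ (ps : List (Subset (Data.Nat.suc n) × Vec (Maybe ℤ) (Data.Nat.suc n))) →
      Unique ps → All (Counted n j) ps →
      (+ length ps) / 1 ≤ (+ 426 / 100) * (((+ 4383 / 1000) - ε) ^ℚ (n ∸ 1)))
lemma15 = ε₀ , toWitness {a? = 0ℚ <? ε₀} tt , T-bound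
  where
  -- T(n) ≤ tailCount n ≤ ρⁿ = 4.26 · ρⁿ⁻¹ ≤ 4.26 · cⁿ⁻¹  (426/100 is ρ in lowest terms).
  T-bound : ∀ ε → 0ℚ < ε → ε < ε₀ → ∀ n → 1 Data.Nat.≤ n → ∀ j ps → Unique ps → All (Counted n j) ps →
    ι (length ps) ≤ (+ 426 / 100) * (((+ 4383 / 1000) - ε) ^ℚ (n ∸ 1))
  T-bound ε _ ε<ε₀ (suc m) (s≤s z≤n) j ps unique counted = begin
    ι (length ps)                              ≤⟨ ι-mono (counted-≤-tailCount (suc m) j ps unique counted) ⟩
    ι (tailCount (suc m))                      ≤⟨ ι-≤-ρ^ (tailCount (suc m)) (suc m) (tailCount-bound (suc m)) ⟩
    ρ * ρ ^ℚ m                                 ≤⟨ *-monoˡ-≤-nonNeg ρ (^ℚ-mono-≤ ρ _ (ρ≤c ε ε<ε₀) m) ⟩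
    ρ * (((+ 4383 / 1000) - ε) ^ℚ m)           ∎
    where open ≤-Reasoning
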